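{- Let $n$ be a positive integer, let $\mathcal{C}$ be the class of binary matroids with at most $n$ elements, and let $\mathbf{BigM}=\mathbb{F}_2^n$ be the complete binary matroid of rank $n$. Then there exists an online matroid morphism (OMM) for $\mathcal{C}$ into $\mathbf{BigM}$.
   Context: All matroids have finite ground sets; a matroid and its ground set are denoted by the same letter, with rank function $\mathrm{rank}_{\mathbf{M}}$. A (matroid) morphism $f:\mathbf{M}\to\mathbf{N}$ is a map between ground sets with $\mathrm{rank}_{\mathbf{N}}(f(S))=\mathrm{rank}_{\mathbf{M}}(S)$ for all $S\subseteq \mathbf{M}$; it is a monomorphism (embedding) if injective. The complete binary matroid $\mathbb{F}_2^n$ has as ground set all vectors of $\mathbb{F}_2^n$ (including $0$), a set being independent iff it is a linearly independent set of vectors. A matroid is binary if it admits a morphism into $\mathbb{F}_2^d$ for some $d$. An ordering of $\mathbf{M}$ (with $|\mathbf{M}|=m$) is a bijection $\pi:[m]\to\mathbf{M}$. For $m'<m$, the prefix-restriction $(\mathbf{M}',\pi')$ of $(\mathbf{M},\pi)$ is the restriction of $\mathbf{M}$ to $\pi([m'])$ together with $\pi'=\pi|_{[m']}$. For a class $\mathcal{C}$ of matroids closed under restriction, an online matroid morphism for $\mathcal{C}$ into a host matroid $\mathbf{BigM}$ is a family of morphisms $f_{\mathbf{M},\pi}:\mathbf{M}\to\mathbf{BigM}$, one for each $\mathbf{M}\in\mathcal{C}$ and each ordering $\pi$ of $\mathbf{M}$, such that for every prefix-restriction $(\mathbf{M}',\pi')$ of $(\mathbf{M},\pi)$, $f_{\mathbf{M}',\pi'}$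 equals the restriction of $f_{\mathbf{M},\pi}$ to $\mathbf{M}'$. -}

module Defs where

open import Data.Nat using (ℕ; zero; suc; _+_; _≤_; _<_)
open import Data.Nat.Properties using (<-irrelevant; ≤-trans; <⇒≤; ≤-reflexive)
open import Data.Fin using (Fin; toℕ; fromℕ<; inject≤)
open import Data.Fin.Properties using (toℕ-inject≤; toℕ-fromℕ<; toℕ-injective)
open import Data.Bool using (Bool; true; false; if_then_else_; _xor_)
open import Data.Vec using (Vec; replicate; zipWith; []; _∷_)
open import Data.List using (List; map; length; _++_)
open import Data.List.Properties using (map-++; length-map)
open import Data.List.Membership.Propositional using (_∈_)
open import Data.List.Membership.Propositional.Properties using (∈-map⁺; ∈-map⁻)
open import Data.Product using (Σ; Σ-syntax; _×_; _,_; proj₁; proj₂)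
open import Function.Bundles using (_↔_; Inverse; mk↔ₛ′)
open import Relation.Binary.PropositionalEquality
  using (_≡_; refl; sym; trans; cong; subst)

-- Matroids (finite ground set), via the rank function.
-- A subset S of the ground set is represented by a list enumerating its
-- elements (duplicates allowed, order irrelevant).

_⊆ˡ_ : {A : Set} → List A → List A → Set
X ⊆ˡ Y = ∀ x → x ∈ X → x ∈ Y

record Matroid : Set₁ where
  field
    E      : Set
    size   : ℕ
    enum   : Fin size ↔ E
    rank   : List E → ℕ
    -- rank axioms (R1)-(R3); R1 lower bound 0 ≤ r is automatic in ℕ
    rank-bound  : ∀ X → rank X ≤ length X
    rank-mono   : ∀ X Y → X ⊆ˡ Y → rank X ≤ rank Y
    -- submodularity  r(X ∪ Y) + r(Z) ≤ r(X) + r(Y)  for every Z ⊆ X ∩ Y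
    -- (equivalent, given monotonicity, to r(X ∪ Y) + r(X ∩ Y) ≤ r(X) + r(Y))
    rank-submod : ∀ X Y Z → Z ⊆ˡ X → Z ⊆ˡ Y →
                  rank (X ++ Y) + rank Z ≤ rank X + rank Y

open Matroid public

-- The complete binary matroid F₂ⁿ : ground set = all vectors in F₂ⁿ,
-- a set is independent iff it is linearly independent, so its rank
-- function sends a set of vectors to the largest size of a linearly
-- independent subset.

F2 : ℕ → Set
F2 n = Vec Bool n

zeroV : ∀ {n} → F2 n
zeroV {n} = replicate n false

_⊕_ : ∀ {n} → F2 n → F2 n → F2 n
_⊕_ = zipWith _xor_

lincomb : ∀ {n} (T : List (F2 n)) → Vec Bool (length T) → F2 n
lincomb List.[] [] = zeroV
lincomb (t List.∷ T) (c ∷ cs) = if c then t ⊕ lincomb T cs else lincomb T cs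

-- a list of vectors is linearly independent (this forces its entries
-- to be pairwise distinct and nonzero, so it is a linearly independent set)
LinIndep : ∀ {n} → List (F2 n) → Set
LinIndep T = ∀ c → lincomb T c ≡ zeroV → c ≡ replicate (length T) false

RankF2 : ∀ {n} → List (F2 n) → ℕ → Set
RankF2 vs r =
  (Σ[ T ∈ List _ ] (LinIndep T × T ⊆ˡ vs × length T ≡ r)) ×
  (∀ T → LinIndep T → T ⊆ˡ vs → length T ≤ r)

IsMorphismF2 : (M : Matroid) (n : ℕ) → (E M → F2 n) → Set
IsMorphismF2 M n f = ∀ S → RankF2 (map f S) (rank M S)

Binary : Matroid → Set
Binary M = Σ[ d ∈ ℕ ] Σ[ f ∈ (E M → F2 d) ] IsMorphismF2 M d f

InC : ℕ → Matroid → Set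
InC n M = Binary M × size M ≤ n

Ordering : Matroid → Set
Ordering M = Fin (size M) ↔ E M

module _ (M : Matroid) (π : Ordering M) (m' : ℕ) (m'≤m : m' ≤ size M) where
  private
    module π = Inverse π

  PrefixE : Set
  PrefixE = Σ[ x ∈ E M ] (toℕ (π.from x) < m')

  private
    toP : Fin m' → PrefixE
    toP i = π.to (inject≤ i m'≤m) ,
            subst (_< m')
                  (sym (trans (cong toℕ (π.strictlyInverseʳ (inject≤ i m'≤m)))
                              (toℕ-inject≤ i m'≤m)))
                  (Data.Fin.Properties.toℕ<n i)
      where import Data.Fin.Properties

    fromP : PrefixE → Fin m'
    fromP (x , p) = fromℕ< p

    invˡ : ∀ y → toP (fromP y) ≡ y
    invˡ (x , p) = Σ≡ (trans (cong π.to eqF) (π.strictlyInverseˡ x))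
      where
      eqF : inject≤ (fromℕ< p) m'≤m ≡ π.from x
      eqF = toℕ-injective (trans (toℕ-inject≤ (fromℕ< p) m'≤m) (toℕ-fromℕ< p))
      Σ≡ : ∀ {a} {q : toℕ (π.from a) < m'} → a ≡ x → (a , q) ≡ (x , p)
      Σ≡ {q = q} refl = cong (x ,_) (<-irrelevant q p)

    invʳ : ∀ i → fromP (toP i) ≡ i
    invʳ i = toℕ-injective
      (trans (toℕ-fromℕ< (proj₂ (toP i)))
             (trans (cong toℕ (π.strictlyInverseʳ (inject≤ i m'≤m)))
                    (toℕ-inject≤ i m'≤m)))

  prefixOrdering : Fin m' ↔ PrefixE
  prefixOrdering = mk↔ₛ′ toP fromP invˡ invʳ

  private
    liftSub : ∀ {X Y : List PrefixE} → X ⊆ˡ Y → map proj₁ X ⊆ˡ map proj₁ Y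
    liftSub {X} {Y} X⊆Y x x∈ with ∈-map⁻ proj₁ x∈
    ... | (y , y∈X , refl) = ∈-map⁺ proj₁ (X⊆Y y y∈X)

  prefixMatroid : Matroid
  prefixMatroid = record
    { E = PrefixE
    ; size = m'
    ; enum = prefixOrdering
    ; rank = λ X → rank M (map proj₁ X)
    ; rank-bound = λ X → subst (rank M (map proj₁ X) ≤_) (length-map proj₁ X)
                                (rank-bound M (map proj₁ X))
    ; rank-mono = λ X Y X⊆Y → rank-mono M _ _ (liftSub X⊆Y)
    ; rank-submod = λ X Y Z Z⊆X Z⊆Y →
        subst (λ L → rank M L + rank M (map proj₁ Z) ≤ rank M (map proj₁ X) + rank M (map proj₁ Y))
              (sym (map-++ proj₁ X Y))
              (rank-submod M _ _ _ (liftSub Z⊆X) (liftSub Z⊆Y))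
    }

-- The family is given on all ordered matroids, but the
-- requirements are imposed only for members of C (values elsewhere are
-- irrelevant).

OnlineMorphism : ℕ → Set₁
OnlineMorphism n =
  Σ[ f ∈ ((M : Matroid) → Ordering M → E M → F2 n) ]
    ( (∀ M (π : Ordering M) → InC n M → IsMorphismF2 M n (f M π))
    × (∀ M (π : Ordering M) → InC n M →
         ∀ m' (m'<m : m' < size M) (x : PrefixE M π m' (<⇒≤ m'<m)) →
           f (prefixMatroid M π m' (<⇒≤ m'<m))
             (prefixOrdering M π m' (<⇒≤ m'<m)) x
           ≡ f M π (proj₁ x)) )

module Submission where

-- Send the element x = π(i) to its coordinate vector with respect to the greedy basis of the prefix
-- π(0), …, π(i): coordinate k is set iff the rank jumps at position k and adding x to the other jump
-- elements raises their rank. Only ranks inside the prefix are read, so the family is online. Given a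
-- representation w : M → F₂ᵈ, the jump positions are the pivots of the list w(π(0)), w(π(1)), …; the
-- pivot vectors are independent and span, and the vector assigned to x is the unique pivot-supported v
-- with Σₖ vₖ w(π(k)) = w(x). Hence the linear map eₖ ↦ w(π(k)), injective on pivot-supported vectors,
-- turns the new map into w, so both have the same linear dependencies and therefore the same ranks.

open import Defs
open import Data.Bool using (Bool; true; false; not; _∧_; _xor_; if_then_else_)
open import Data.Bool.Properties
  using (xor-comm; xor-assoc; xor-identityˡ; xor-same; ∧-zeroʳ; ∧-conicalˡ; ∧-conicalʳ; not-¬)
  renaming (_≟_ to _≟ᴮ_)
open import Data.Empty using (⊥; ⊥-elim)
open import Data.Fin using (Fin; zero; suc; toℕ; fromℕ<; combine; remQuot; inject≤)
open import Data.Fin.Properties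
  using (2↔Bool; combine-injective; combine-remQuot; injective⇒≤; toℕ-fromℕ<)
open import Data.List using (List; []; _∷_; map; length; take; _++_; [_]; tabulate)
open import Data.List.Properties
  using (length-map; length-take; length-tabulate; take-take; take-all; take-map; take-suc-tabulate;
         map-tabulate; map-∘; map-cong)
open import Data.List.Membership.Propositional using (_∈_)
open import Data.List.Membership.Propositional.Properties
  using (∈-map⁺; ∈-map⁻; ∈-++⁻; ∈-++⁺ˡ; ∈-++⁺ʳ)
open import Data.List.Relation.Unary.Any using (here; there)
open import Data.Nat using (ℕ; zero; suc; _≤_; _<_; _^_; _⊓_; z≤n; s≤s; s≤s⁻¹; s<s⁻¹; _<?_)
  renaming (_≟_ to _≟ℕ_)
open import Data.Nat.Properties
  using (suc-injective; ≤-refl; ≤-reflexive; ≤-trans; ≤-antisym; <⇒≤; <-≤-trans; <-irrefl;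
         n≮0; n≮n; <⇒≱; ≤⇒≯; ≮⇒≥; m<1+n⇒m<n∨m≡n; m≤n⇒m⊓n≡m; m⊓n≤m; m⊓n≤n; ^-monoʳ-<)
open import Data.Product as Product using (Σ-syntax; ∃; _×_; _,_; proj₁; proj₂)
open import Data.Sum as Sum using (_⊎_; inj₁; inj₂)
open import Data.Vec using (Vec; []; _∷_; cast)
open import Data.Vec.Properties using (≡-dec; ∷-injective)
open import Data.Vec.Relation.Binary.Pointwise.Inductive
  using (Pointwise-≡⇒≡; zipWith-comm; zipWith-assoc; zipWith-identityˡ)
open import Function using (_∘_)
open import Function.Bundles using (Inverse; Equivalence; _⇔_; mk⇔)
open import Relation.Nullary using (Dec; yes; no; ¬_; does)
open import Relation.Nullary.Decidable using (map′; _⊎-dec_; dec-true; dec-false)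
open import Relation.Binary.PropositionalEquality
  using (_≡_; refl; sym; trans; cong; cong₂; subst; module ≡-Reasoning)

private variable
  d k m n r r′ : ℕ
  P : ℕ → Set
  A B : List (F2 d)
  x y : F2 d

-- Vectors over F₂

⊕-comm : (u v : F2 n) → u ⊕ v ≡ v ⊕ u
⊕-comm u v = Pointwise-≡⇒≡ (zipWith-comm xor-comm u v)

⊕-assoc : (u v t : F2 n) → (u ⊕ v) ⊕ t ≡ u ⊕ (v ⊕ t)
⊕-assoc u v t = Pointwise-≡⇒≡ (zipWith-assoc xor-assoc u v t)

⊕-identityˡ : (u : F2 n) → zeroV ⊕ u ≡ u
⊕-identityˡ u = Pointwise-≡⇒≡ (zipWith-identityˡ xor-identityˡ u)

⊕-identityʳ : (u : F2 n) → u ⊕ zeroV ≡ u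
⊕-identityʳ u = trans (⊕-comm u zeroV) (⊕-identityˡ u)

⊕-self : (u : F2 n) → u ⊕ u ≡ zeroV
⊕-self []      = refl
⊕-self (b ∷ u) = cong₂ _∷_ (xor-same b) (⊕-self u)

⊕≡zero⇒≡ : (u v : F2 n) → u ⊕ v ≡ zeroV → u ≡ v
⊕≡zero⇒≡ u v eq = begin
  u                ≡⟨ sym (⊕-identityʳ u) ⟩
  u ⊕ zeroV        ≡⟨ cong (u ⊕_) (sym (⊕-self v)) ⟩
  u ⊕ (v ⊕ v)      ≡⟨ sym (⊕-assoc u v v) ⟩
  (u ⊕ v) ⊕ v      ≡⟨ cong (_⊕ v) eq ⟩
  zeroV ⊕ v        ≡⟨ ⊕-identityˡ v ⟩
  v                ∎
  where open ≡-Reasoning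

⊕-interchange : (u v s t : F2 n) → (u ⊕ v) ⊕ (s ⊕ t) ≡ (u ⊕ s) ⊕ (v ⊕ t)
⊕-interchange u v s t = begin
  (u ⊕ v) ⊕ (s ⊕ t)  ≡⟨ ⊕-assoc u v (s ⊕ t) ⟩
  u ⊕ (v ⊕ (s ⊕ t))  ≡⟨ cong (u ⊕_) (sym (⊕-assoc v s t)) ⟩
  u ⊕ ((v ⊕ s) ⊕ t)  ≡⟨ cong (λ z → u ⊕ (z ⊕ t)) (⊕-comm v s) ⟩
  u ⊕ ((s ⊕ v) ⊕ t)  ≡⟨ cong (u ⊕_) (⊕-assoc s v t) ⟩
  u ⊕ (s ⊕ (v ⊕ t))  ≡⟨ sym (⊕-assoc u s (v ⊕ t)) ⟩
  (u ⊕ s) ⊕ (v ⊕ t)  ∎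
  where open ≡-Reasoning

_≟_ : (u v : F2 n) → Dec (u ≡ v)
_≟_ = ≡-dec _≟ᴮ_

_!_ : F2 n → ℕ → Bool
[]      ! k     = false
(b ∷ v) ! zero  = b
(b ∷ v) ! suc k = v ! k

!-zero : ∀ n k → zeroV {n} ! k ≡ false
!-zero zero    k       = refl
!-zero (suc n) zero    = refl
!-zero (suc n) (suc k) = !-zero n k

!-⊕ : (u v : F2 n) (k : ℕ) → (u ⊕ v) ! k ≡ (u ! k) xor (v ! k)
!-⊕ []      []      k       = refl
!-⊕ (a ∷ u) (b ∷ v) zero    = refl
!-⊕ (a ∷ u) (b ∷ v) (suc k) = !-⊕ u v k

!-true⇒< : (v : F2 n) (k : ℕ) → v ! k ≡ true → k < n
!-true⇒< (b ∷ v) zero    _ = s≤s z≤n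
!-true⇒< (b ∷ v) (suc k) e = s≤s (!-true⇒< v k e)

tab : (n : ℕ) → (ℕ → Bool) → F2 n
tab zero    f = []
tab (suc n) f = f 0 ∷ tab n (f ∘ suc)

tab-cong : ∀ n {f f′ : ℕ → Bool} → (∀ k → f k ≡ f′ k) → tab n f ≡ tab n f′
tab-cong zero    _    = refl
tab-cong (suc n) f≗f′ = cong₂ _∷_ (f≗f′ 0) (tab-cong n (f≗f′ ∘ suc))

tab-! : {f : ℕ → Bool} (v : F2 n) → (∀ k → k < n → f k ≡ v ! k) → tab n f ≡ v
tab-! []      _ = refl
tab-! (b ∷ v) f≗v = cong₂ _∷_ (f≗v 0 (s≤s z≤n)) (tab-! v (λ k k<n → f≗v (suc k) (s≤s k<n)))

unit : ℕ → F2 n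
unit {zero}  _       = []
unit {suc n} zero    = true ∷ zeroV
unit {suc n} (suc k) = false ∷ unit k

unit-! : ∀ {n} k {j} → unit {n} k ! j ≡ true → j ≡ k
unit-! {suc n} zero    {zero}  _ = refl
unit-! {suc n} zero    {suc j} e with () ← trans (sym e) (!-zero n j)
unit-! {suc n} (suc k) {suc j} e = cong suc (unit-! {n} k e)

unit-!-self : ∀ {n} k → k < n → unit {n} k ! k ≡ true
unit-!-self zero    (s≤s _)   = refl
unit-!-self (suc k) (s≤s k<n) = unit-!-self k k<n

Supported : (ℕ → Set) → F2 n → Set
Supported P v = ∀ k → v ! k ≡ true → P k

Supported-zero : ∀ n → Supported P (zeroV {n})
Supported-zero n k eq with () ← trans (sym eq) (!-zero n k)

Supported-⊕ : (u v : F2 n) → Supported P u → Supported P v → Supported P (u ⊕ v)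
Supported-⊕ []          []      _   _   k       ()
Supported-⊕ (true  ∷ u) (b ∷ v) u⊆P v⊆P zero    _  = u⊆P zero refl
Supported-⊕ (false ∷ u) (b ∷ v) u⊆P v⊆P zero    eq = v⊆P zero eq
Supported-⊕ (a ∷ u)     (b ∷ v) u⊆P v⊆P (suc k) eq =
  Supported-⊕ u v (u⊆P ∘ suc) (v⊆P ∘ suc) k eq

Supported-∅ : (v : F2 n) → Supported (λ _ → ⊥) v → v ≡ zeroV
Supported-∅ []          _   = refl
Supported-∅ (true  ∷ v) v⊆∅ = ⊥-elim (v⊆∅ zero refl)
Supported-∅ (false ∷ v) v⊆∅ = cong (false ∷_) (Supported-∅ v (v⊆∅ ∘ suc))

Supported-narrow : ∀ {i} (v : F2 n) → Supported (_< suc i) v → v ! i ≡ false → Supported (_< i) v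
Supported-narrow v v<1+i vᵢ k vₖ with m<1+n⇒m<n∨m≡n (v<1+i k vₖ)
... | inj₁ k<i  = k<i
... | inj₂ refl with () ← trans (sym vᵢ) vₖ

-- Linear combinations and spans

-- c · T is the combination Σₖ cₖ Tₖ, truncated to the shorter of c and T.
infix 25 _·_
_·_ : Vec Bool m → List (F2 d) → F2 d
[]      · T       = zeroV
(b ∷ c) · []      = zeroV
(b ∷ c) · (t ∷ T) = if b then t ⊕ (c · T) else c · T

lincomb≡· : (T : List (F2 d)) (c : Vec Bool (length T)) → lincomb T c ≡ c · T
lincomb≡· []      []           = refl
lincomb≡· (t ∷ T) (true  ∷ c) = cong (t ⊕_) (lincomb≡· T c)
lincomb≡· (t ∷ T) (false ∷ c) = lincomb≡· T c

·-zeroˡ : ∀ m (T : List (F2 d)) → zeroV {m} · T ≡ zeroV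
·-zeroˡ zero    T       = refl
·-zeroˡ (suc m) []      = refl
·-zeroˡ (suc m) (t ∷ T) = ·-zeroˡ m T

·-⊕ : (u v : Vec Bool m) (T : List (F2 d)) → (u ⊕ v) · T ≡ u · T ⊕ v · T
·-⊕ []      []      T  = sym (⊕-identityˡ zeroV)
·-⊕ (a ∷ u) (b ∷ v) [] = sym (⊕-identityˡ zeroV)
·-⊕ (true ∷ u) (true ∷ v) (t ∷ T) = begin
  (u ⊕ v) · T                      ≡⟨ ·-⊕ u v T ⟩
  u · T ⊕ v · T                    ≡⟨ sym (⊕-identityˡ _) ⟩
  zeroV ⊕ (u · T ⊕ v · T)          ≡⟨ cong (_⊕ _) (sym (⊕-self t)) ⟩
  (t ⊕ t) ⊕ (u · T ⊕ v · T)        ≡⟨ ⊕-interchange t t (u · T) (v · T) ⟩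
  (t ⊕ u · T) ⊕ (t ⊕ v · T)        ∎
  where open ≡-Reasoning
·-⊕ (true ∷ u) (false ∷ v) (t ∷ T) =
  trans (cong (t ⊕_) (·-⊕ u v T)) (sym (⊕-assoc t (u · T) (v · T)))
·-⊕ (false ∷ u) (true ∷ v) (t ∷ T) = begin
  t ⊕ (u ⊕ v) · T                  ≡⟨ cong (t ⊕_) (·-⊕ u v T) ⟩
  t ⊕ (u · T ⊕ v · T)              ≡⟨ sym (⊕-assoc t (u · T) (v · T)) ⟩
  (t ⊕ u · T) ⊕ v · T              ≡⟨ cong (_⊕ v · T) (⊕-comm t (u · T)) ⟩
  (u · T ⊕ t) ⊕ v · T              ≡⟨ ⊕-assoc (u · T) t (v · T) ⟩
  u · T ⊕ (t ⊕ v · T)              ∎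
  where open ≡-Reasoning
·-⊕ (false ∷ u) (false ∷ v) (t ∷ T) = ·-⊕ u v T

·-natural : {d′ : ℕ} (L : F2 d → F2 d′) → (∀ u v → L (u ⊕ v) ≡ L u ⊕ L v) →
            L zeroV ≡ zeroV → (c : Vec Bool m) (T : List (F2 d)) → L (c · T) ≡ c · map L T
·-natural L L-⊕ L-0 []          T       = L-0
·-natural L L-⊕ L-0 (b ∷ c)     []      = L-0
·-natural L L-⊕ L-0 (true ∷ c)  (t ∷ T) =
  trans (L-⊕ t (c · T)) (cong (L t ⊕_) (·-natural L L-⊕ L-0 c T))
·-natural L L-⊕ L-0 (false ∷ c) (t ∷ T) = ·-natural L L-⊕ L-0 c T

infix 25 _‼_
_‼_ : List (F2 d) → ℕ → F2 d
[]      ‼ k     = zeroV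
(t ∷ T) ‼ zero  = t
(t ∷ T) ‼ suc k = T ‼ k

unit-· : ∀ {n} k → k < n → (T : List (F2 d)) → unit {n} k · T ≡ T ‼ k
unit-·             zero    (s≤s _)   []      = refl
unit-· {n = suc n} zero    (s≤s _)   (t ∷ T) = trans (cong (t ⊕_) (·-zeroˡ n T)) (⊕-identityʳ t)
unit-·             (suc k) (s≤s _)   []      = refl
unit-·             (suc k) (s≤s k<n) (t ∷ T) = unit-· k k<n T

Supported-· : (c : Vec Bool m) (T : List (F2 n)) →
              (∀ t → t ∈ T → Supported P t) → Supported P (c · T)
Supported-· {n = n} []          T       _   = Supported-zero n
Supported-· {n = n} (b ∷ c)     []      _   = Supported-zero n
Supported-·         (true ∷ c)  (t ∷ T) T⊆P =
  Supported-⊕ t (c · T) (T⊆P t (here refl)) (Supported-· c T (λ t′ → T⊆P t′ ∘ there))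
Supported-·         (false ∷ c) (t ∷ T) T⊆P = Supported-· c T (λ t′ → T⊆P t′ ∘ there)

Span : List (F2 d) → F2 d → Set
Span A y = Σ[ c ∈ Vec Bool (length A) ] c · A ≡ y

span-zero : Span A zeroV
span-zero {A = A} = zeroV , ·-zeroˡ (length A) A

span-⊕ : Span A x → Span A y → Span A (x ⊕ y)
span-⊕ {A = A} (c , refl) (c′ , refl) = c ⊕ c′ , ·-⊕ c c′ A

span-∷ : Span A y → Span (x ∷ A) y
span-∷ (c , eq) = false ∷ c , eq

span-∈ : x ∈ A → Span A x
span-∈ {A = x ∷ A} (here refl)  =
  true ∷ zeroV , trans (cong (x ⊕_) (·-zeroˡ (length A) A)) (⊕-identityʳ x)
span-∈             (there x∈A) = span-∷ (span-∈ x∈A)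

span-closed : {R : F2 d → Set} → R zeroV → (∀ {u v} → R u → R v → R (u ⊕ v)) →
              (∀ a → a ∈ A → R a) → Span A y → R y
span-closed {A = []}    R-0 R-⊕ _    ([] , refl)        = R-0
span-closed {A = a ∷ A} R-0 R-⊕ A⊆R (true ∷ c , refl)  =
  R-⊕ (A⊆R a (here refl)) (span-closed R-0 R-⊕ (λ a′ → A⊆R a′ ∘ there) (c , refl))
span-closed {A = a ∷ A} R-0 R-⊕ A⊆R (false ∷ c , refl) =
  span-closed R-0 R-⊕ (λ a′ → A⊆R a′ ∘ there) (c , refl)

span-⊆ : (∀ a → a ∈ A → Span B a) → Span A y → Span B y
span-⊆ = span-closed span-zero span-⊕

·∈span : (c : Vec Bool m) (A : List (F2 d)) → Span A (c · A)
·∈span []          A       = span-zero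
·∈span (b ∷ c)     []      = span-zero
·∈span (true ∷ c)  (t ∷ A) = span-⊕ (span-∈ (here refl)) (span-∷ (·∈span c A))
·∈span (false ∷ c) (t ∷ A) = span-∷ (·∈span c A)

∃-Vec-Bool? : {P : Vec Bool m → Set} → (∀ c → Dec (P c)) → Dec (∃ P)
∃-Vec-Bool? {zero}  P? = map′ ([] ,_) (λ { ([] , p) → p }) (P? [])
∃-Vec-Bool? {suc m} P? =
  map′ (λ { (inj₁ (c , p)) → true ∷ c , p ; (inj₂ (c , p)) → false ∷ c , p })
       (λ { (true ∷ c , p) → inj₁ (c , p) ; (false ∷ c , p) → inj₂ (c , p) })
       (∃-Vec-Bool? (P? ∘ (true ∷_)) ⊎-dec ∃-Vec-Bool? (P? ∘ (false ∷_)))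

span? : (A : List (F2 d)) (y : F2 d) → Dec (Span A y)
span? A y = ∃-Vec-Bool? (λ c → c · A ≟ y)

LinIndep-∷ : LinIndep A → ¬ Span A x → LinIndep (x ∷ A)
LinIndep-∷ {A = A} {x = x} A-indep x∉⟨A⟩ (true ∷ c) eq =
  ⊥-elim (x∉⟨A⟩ (c , trans (sym (lincomb≡· A c)) (sym (⊕≡zero⇒≡ x (lincomb A c) eq))))
LinIndep-∷ A-indep x∉⟨A⟩ (false ∷ c) eq = cong (false ∷_) (A-indep c eq)

·-injective : LinIndep A → (c c′ : Vec Bool (length A)) → c · A ≡ c′ · A → c ≡ c′
·-injective {A = A} A-indep c c′ eq = ⊕≡zero⇒≡ c c′ (A-indep (c ⊕ c′) (begin
  lincomb A (c ⊕ c′)  ≡⟨ lincomb≡· A (c ⊕ c′) ⟩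
  (c ⊕ c′) · A        ≡⟨ ·-⊕ c c′ A ⟩
  c · A ⊕ c′ · A      ≡⟨ cong (_⊕ c′ · A) eq ⟩
  c′ · A ⊕ c′ · A     ≡⟨ ⊕-self (c′ · A) ⟩
  zeroV               ∎))
  where open ≡-Reasoning

encode : Vec Bool m → Fin (2 ^ m)
encode []      = zero
encode (b ∷ c) = combine (Inverse.from 2↔Bool b) (encode c)

decode : Fin (2 ^ m) → Vec Bool m
decode {zero}  _ = []
decode {suc m} i = Inverse.to 2↔Bool (proj₁ qr) ∷ decode (proj₂ qr)
  where qr = remQuot {2} (2 ^ m) i

encode-decode : ∀ m (i : Fin (2 ^ m)) → encode (decode {m} i) ≡ i
encode-decode zero    zero = refl
encode-decode (suc m) i    =
  trans (cong₂ combine (Inverse.strictlyInverseʳ 2↔Bool (proj₁ qr)) (encode-decode m (proj₂ qr)))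
        (combine-remQuot {2} (2 ^ m) i)
  where qr = remQuot {2} (2 ^ m) i

encode-injective : (c c′ : Vec Bool m) → encode c ≡ encode c′ → c ≡ c′
encode-injective []      []        _  = refl
encode-injective (b ∷ c) (b′ ∷ c′) eq with combine-injective _ _ _ _ eq
... | bits , rest = cong₂ _∷_ b≡b′ (encode-injective c c′ rest)
  where
  open Inverse 2↔Bool
  b≡b′ : b ≡ b′
  b≡b′ = trans (sym (strictlyInverseˡ b)) (trans (cong to bits) (strictlyInverseˡ b′))

injection⇒≤ : ∀ {m n} (h : Vec Bool m → Vec Bool n) →
              (∀ c c′ → h c ≡ h c′ → c ≡ c′) → m ≤ n
injection⇒≤ {m} h h-injective =
  ≮⇒≥ λ n<m → <⇒≱ (^-monoʳ-< 2 (s≤s (s≤s z≤n)) n<m)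
                   (injective⇒≤ {f = encode ∘ h ∘ decode {m}} injective)
  where
  injective : ∀ {i j} → encode (h (decode {m} i)) ≡ encode (h (decode j)) → i ≡ j
  injective {i} {j} eq = trans (sym (encode-decode m i))
    (trans (cong encode (h-injective _ _ (encode-injective _ _ eq))) (encode-decode m j))

steinitz : {T : List (F2 d)} → LinIndep T → (∀ t → t ∈ T → Span A t) → length T ≤ length A
steinitz {A = A} {T = T} T-indep T⊆⟨A⟩ = injection⇒≤ (proj₁ ∘ image) λ c c′ eq →
  ·-injective T-indep c c′ (trans (sym (proj₂ (image c))) (trans (cong (_· A) eq) (proj₂ (image c′))))
  where
  image : (c : Vec Bool (length T)) → Span A (c · T)
  image c = span-⊆ T⊆⟨A⟩ (c , refl)

-- Ranks of lists of vectors

RankF2-cong : A ⊆ˡ B → B ⊆ˡ A → RankF2 A r → RankF2 B r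
RankF2-cong A⊆B B⊆A ((T , T-indep , T⊆A , refl) , maximal) =
  (T , T-indep , (λ t → A⊆B t ∘ T⊆A t) , refl) ,
  λ T′ T′-indep T′⊆B → maximal T′ T′-indep (λ t → B⊆A t ∘ T′⊆B t)

RankF2-unique : RankF2 A r → RankF2 A r′ → r ≡ r′
RankF2-unique ((T , T-indep , T⊆A , refl) , maximal) ((T′ , T′-indep , T′⊆A , refl) , maximal′) =
  ≤-antisym (maximal′ T T-indep T⊆A) (maximal T′ T′-indep T′⊆A)

RankF2⇒basis : RankF2 A r →
               Σ[ T ∈ List (F2 d) ]
                 LinIndep T × T ⊆ˡ A × length T ≡ r × (∀ a → a ∈ A → Span T a)
RankF2⇒basis {A = A} ((T , T-indep , T⊆A , refl) , maximal) = T , T-indep , T⊆A , refl , A⊆⟨T⟩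
  where
  A⊆⟨T⟩ : ∀ a → a ∈ A → Span T a
  A⊆⟨T⟩ a a∈A with span? T a
  ... | yes a∈⟨T⟩ = a∈⟨T⟩
  ... | no  a∉⟨T⟩ = ⊥-elim (n≮n _ (maximal (a ∷ T) (LinIndep-∷ T-indep a∉⟨T⟩)
                      λ { _ (here refl) → a∈A ; t (there t∈T) → T⊆A t t∈T }))

rank-∷-¬span : RankF2 A r → RankF2 (x ∷ A) r′ → ¬ Span A x → r < r′
rank-∷-¬span {x = x} rank-A (_ , maximal) x∉⟨A⟩ with RankF2⇒basis rank-A
... | T , T-indep , T⊆A , refl , _ =
  maximal (x ∷ T) (LinIndep-∷ T-indep (x∉⟨A⟩ ∘ span-⊆ (λ t → span-∈ ∘ T⊆A t)))
    λ { _ (here refl) → here refl ; t (there t∈T) → there (T⊆A t t∈T) }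

rank-∷-span : RankF2 A r → RankF2 (x ∷ A) r′ → Span A x → r′ ≤ r
rank-∷-span rank-A ((T′ , T′-indep , T′⊆xA , refl) , _) x∈⟨A⟩ with RankF2⇒basis rank-A
... | T , _ , _ , refl , A⊆⟨T⟩ = steinitz T′-indep λ t t∈T′ → xA⊆⟨T⟩ t (T′⊆xA t t∈T′)
  where
  xA⊆⟨T⟩ : ∀ t → t ∈ _ ∷ _ → Span T t
  xA⊆⟨T⟩ t (here refl)  = span-⊆ A⊆⟨T⟩ x∈⟨A⟩
  xA⊆⟨T⟩ t (there t∈A) = A⊆⟨T⟩ t t∈A

rank-∷ : RankF2 A r → RankF2 (x ∷ A) r′ → does (r <? r′) ≡ not (does (span? A x))
rank-∷ {A = A} {r = r} {x = x} {r′ = r′} rank-A rank-xA with span? A x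
... | yes x∈⟨A⟩ = dec-false (r <? r′) (≤⇒≯ (rank-∷-span rank-A rank-xA x∈⟨A⟩))
... | no  x∉⟨A⟩ = dec-true (r <? r′) (rank-∷-¬span rank-A rank-xA x∉⟨A⟩)

RankF2-∷ʳ : RankF2 (A ++ [ x ]) r → RankF2 (x ∷ A) r
RankF2-∷ʳ {A = A} = RankF2-cong snoc⊆cons cons⊆snoc
  where
  snoc⊆cons : (A ++ [ _ ]) ⊆ˡ (_ ∷ A)
  snoc⊆cons t t∈ with ∈-++⁻ A t∈
  ... | inj₁ t∈A         = there t∈A
  ... | inj₂ (here refl) = here refl
  cons⊆snoc : (_ ∷ A) ⊆ˡ (A ++ [ _ ])
  cons⊆snoc t (here refl) = ∈-++⁺ʳ A (here refl)
  cons⊆snoc t (there t∈A) = ∈-++⁺ˡ t∈A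

·-cast : .(eq : m ≡ n) (c : Vec Bool m) (T : List (F2 d)) → cast eq c · T ≡ c · T
·-cast {n = zero}  eq []          T       = refl
·-cast {n = suc n} eq (b ∷ c)     []      = refl
·-cast {n = suc n} eq (true ∷ c)  (t ∷ T) = cong (t ⊕_) (·-cast (suc-injective eq) c T)
·-cast {n = suc n} eq (false ∷ c) (t ∷ T) = ·-cast (suc-injective eq) c T

cast-zero⁻ : .(eq : m ≡ n) (c : Vec Bool m) → cast eq c ≡ zeroV → c ≡ zeroV
cast-zero⁻ {n = zero}  eq []      _  = refl
cast-zero⁻ {n = suc n} eq (b ∷ c) c≡0 =
  cong₂ _∷_ (proj₁ (∷-injective c≡0)) (cast-zero⁻ (suc-injective eq) c (proj₂ (∷-injective c≡0)))

map-⊆ˡ : {E X : Set} (f : E → X) {U S : List E} → U ⊆ˡ S → map f U ⊆ˡ map f S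
map-⊆ˡ f U⊆S y y∈fU with ∈-map⁻ f y∈fU
... | u , u∈U , refl = ∈-map⁺ f (U⊆S u u∈U)

⊆ˡ-map⁻ : {E X : Set} (f : E → X) {T : List X} {S : List E} → T ⊆ˡ map f S →
          Σ[ U ∈ List E ] U ⊆ˡ S × map f U ≡ T
⊆ˡ-map⁻ f {[]}    _     = [] , (λ _ ()) , refl
⊆ˡ-map⁻ f {t ∷ T} T⊆fS
  with ∈-map⁻ f (T⊆fS t (here refl)) | ⊆ˡ-map⁻ f (λ y → T⊆fS y ∘ there)
... | u , u∈S , refl | U , U⊆S , refl =
  u ∷ U , (λ { _ (here refl) → u∈S ; v (there v∈U) → U⊆S v v∈U }) , refl

length-map₂ : {E X Y : Set} (g : E → X) (h : E → Y) (U : List E) →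
              length (map g U) ≡ length (map h U)
length-map₂ g h U = trans (length-map g U) (sym (length-map h U))

SameDependencies : {E : Set} {a b : ℕ} → (E → F2 a) → (E → F2 b) → Set
SameDependencies g h = ∀ {m} (c : Vec Bool m) U → c · map g U ≡ zeroV ⇔ c · map h U ≡ zeroV

LinIndep-map : {E : Set} {a b : ℕ} (g : E → F2 a) (h : E → F2 b) (U : List E) →
               (∀ {m} (c : Vec Bool m) → c · map h U ≡ zeroV → c · map g U ≡ zeroV) →
               LinIndep (map g U) → LinIndep (map h U)
LinIndep-map g h U h⇒g g-indep c eq = cast-zero⁻ length-eq c (g-indep (cast length-eq c) (begin
  lincomb (map g U) (cast length-eq c)  ≡⟨ lincomb≡· (map g U) _ ⟩
  cast length-eq c · map g U            ≡⟨ ·-cast length-eq c (map g U) ⟩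
  c · map g U                           ≡⟨ h⇒g c (trans (sym (lincomb≡· (map h U) c)) eq) ⟩
  zeroV                                 ∎))
  where
  open ≡-Reasoning
  length-eq = length-map₂ h g U

RankF2-map : {E : Set} {a b : ℕ} (g : E → F2 a) (h : E → F2 b) → SameDependencies g h →
             (S : List E) → RankF2 (map g S) r → RankF2 (map h S) r
RankF2-map g h same S ((T , T-indep , T⊆gS , refl) , maximal) with ⊆ˡ-map⁻ g T⊆gS
... | U , U⊆S , refl =
  (map h U , LinIndep-map g h U (λ c → Equivalence.from (same c U)) T-indep , map-⊆ˡ h U⊆S ,
   length-map₂ h g U) ,
  bound
  where
  bound : ∀ T′ → LinIndep T′ → T′ ⊆ˡ map h S → length T′ ≤ length (map g U)
  bound T′ T′-indep T′⊆hS with ⊆ˡ-map⁻ h T′⊆hS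
  ... | U′ , U′⊆S , refl = subst (_≤ length (map g U)) (length-map₂ g h U′)
    (maximal (map g U′) (LinIndep-map h g U′ (λ c → Equivalence.to (same c U′)) T′-indep)
             (map-⊆ˡ g U′⊆S))

-- Pivots of a list of vectors

SpanOn : (n : ℕ) → (ℕ → Set) → List (F2 d) → F2 d → Set
SpanOn n P V y = Σ[ v ∈ F2 n ] Supported P v × v · V ≡ y

module _ {V : List (F2 d)} where

  SpanOn-zero : SpanOn n P V zeroV
  SpanOn-zero {n = n} = zeroV , Supported-zero n , ·-zeroˡ n V

  SpanOn-⊕ : SpanOn n P V x → SpanOn n P V y → SpanOn n P V (x ⊕ y)
  SpanOn-⊕ (u , u⊆P , refl) (v , v⊆P , refl) = u ⊕ v , Supported-⊕ u v u⊆P v⊆P , ·-⊕ u v V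

select : {X : Set} → (ℕ → Bool) → List X → List X
select S []       = []
select S (x ∷ xs) = if S 0 then x ∷ select (S ∘ suc) xs else select (S ∘ suc) xs

select-map : {X Y : Set} (f : X → Y) (S : ℕ → Bool) (xs : List X) →
             map f (select S xs) ≡ select S (map f xs)
select-map f S []       = refl
select-map f S (x ∷ xs) with S 0
... | true  = cong (f x ∷_) (select-map f (S ∘ suc) xs)
... | false = select-map f (S ∘ suc) xs

select-cong : {X : Set} {S S′ : ℕ → Bool} → (∀ k → S k ≡ S′ k) → (xs : List X) →
              select S xs ≡ select S′ xs
select-cong S≗S′ []       = refl
select-cong {S = S} {S′} S≗S′ (x ∷ xs) with S 0 | S′ 0 | S≗S′ 0
... | true  | true  | refl = cong (x ∷_) (select-cong (S≗S′ ∘ suc) xs)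
... | false | false | refl = select-cong (S≗S′ ∘ suc) xs

span-select⇒SpanOn : (S : ℕ → Bool) (V : List (F2 d)) → length V ≤ n →
                     Span (select S V) y → SpanOn n (λ k → S k ≡ true) V y
span-select⇒SpanOn {n = n} S [] _ ([] , refl) = SpanOn-zero {n = n}
span-select⇒SpanOn {n = suc n} S (t ∷ V) (s≤s V≤n) span with S 0 in S0 | span
... | true  | b ∷ c , refl =
  let v , v⊆S , eq = span-select⇒SpanOn (S ∘ suc) V V≤n (c , refl) in
  b ∷ v , (λ { zero _ → S0 ; (suc k) → v⊆S k }) , cong (λ z → if b then t ⊕ z else z) eq
... | false | c , refl =
  let v , v⊆S , eq = span-select⇒SpanOn (S ∘ suc) V V≤n (c , refl) in
  false ∷ v , (λ { zero () ; (suc k) → v⊆S k }) , eq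

SpanOn⇒span-select : (S : ℕ → Bool) (V : List (F2 d)) →
                     SpanOn n (λ k → S k ≡ true) V y → Span (select S V) y
SpanOn⇒span-select S V       ([]    , _   , refl) = span-zero
SpanOn⇒span-select S []      (b ∷ v , _   , refl) = span-zero
SpanOn⇒span-select S (t ∷ V) (b ∷ v , v⊆S , refl) with S 0 in S0 | b | v⊆S zero
... | true  | true  | _ = span-⊕ (span-∈ (here refl)) (span-∷ rest)
  where rest = SpanOn⇒span-select (S ∘ suc) V (v , v⊆S ∘ suc , refl)
... | true  | false | _ = span-∷ (SpanOn⇒span-select (S ∘ suc) V (v , v⊆S ∘ suc , refl))
... | false | true  | v₀⊆S with () ← v₀⊆S refl
... | false | false | _ = SpanOn⇒span-select (S ∘ suc) V (v , v⊆S ∘ suc , refl)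

·-take : ∀ {i} (v : Vec Bool m) (V : List (F2 d)) → Supported (_< i) v → v · take i V ≡ v · V
·-take                    []      V       _     = refl
·-take {m = m} {i = zero}  v       V       v<0   rewrite Supported-∅ v (λ k → n≮0 ∘ v<0 k) =
  trans (·-zeroˡ m []) (sym (·-zeroˡ m V))
·-take         {i = suc i} (b ∷ v) []      _     = refl
·-take         {i = suc i} (b ∷ v) (t ∷ V) v<1+i =
  cong (λ z → if b then t ⊕ z else z) (·-take v V (λ k → s<s⁻¹ ∘ v<1+i (suc k)))

‼-beyond : (V : List (F2 d)) → length V ≤ k → V ‼ k ≡ zeroV
‼-beyond []      _         = refl
‼-beyond (t ∷ V) (s≤s V≤k) = ‼-beyond V V≤k

take-suc-‼ : ∀ i (V : List (F2 d)) →
             take (suc i) V ≡ take i V ++ [ V ‼ i ] ⊎ (take (suc i) V ≡ take i V × V ‼ i ≡ zeroV)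
take-suc-‼ zero    []      = inj₂ (refl , refl)
take-suc-‼ (suc i) []      = inj₂ (refl , refl)
take-suc-‼ zero    (t ∷ V) = inj₁ refl
take-suc-‼ (suc i) (t ∷ V) = Sum.map (cong (t ∷_)) (Product.map₁ (cong (t ∷_))) (take-suc-‼ i V)

‼-take : ∀ {i k} (V : List (F2 d)) → k < i → take i V ‼ k ≡ V ‼ k
‼-take {i = suc i}         []      _         = refl
‼-take {i = suc i} {zero}  (t ∷ V) _         = refl
‼-take {i = suc i} {suc k} (t ∷ V) (s≤s k<i) = ‼-take V k<i

module _ (V : List (F2 d)) where

  isPivot : ℕ → Bool
  isPivot k = not (does (span? (take k V) (V ‼ k)))

  Pivot : ℕ → Set
  Pivot k = isPivot k ≡ true

  pivot⇒∉span : Pivot k → ¬ Span (take k V) (V ‼ k)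
  pivot⇒∉span {k} pivot span with span? (take k V) (V ‼ k) | pivot
  ... | no ∉span | _ = ∉span span

  ¬pivot⇒∈span : isPivot k ≡ false → Span (take k V) (V ‼ k)
  ¬pivot⇒∈span {k} ¬pivot with span? (take k V) (V ‼ k) | ¬pivot
  ... | yes ∈span | _ = ∈span

  pivot⇒<length : Pivot k → k < length V
  pivot⇒<length {k} pivot with k <? length V
  ... | yes k<len = k<len
  ... | no  k≮len =
    ⊥-elim (pivot⇒∉span pivot (subst (Span _) (sym (‼-beyond V (≮⇒≥ k≮len))) span-zero))

  pivots-independent : (v : F2 n) → Supported Pivot v → v · V ≡ zeroV → v ≡ zeroV
  pivots-independent {n} v v⊆pivots = below n v v⊆pivots (!-true⇒< v)
    where
    below : ∀ i (v : F2 n) → Supported Pivot v → Supported (_< i) v → v · V ≡ zeroV → v ≡ zeroV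
    below zero    v _         v<0   _      = Supported-∅ v (λ k → n≮0 ∘ v<0 k)
    below (suc i) v v⊆pivots v<1+i v·V≡0 with v ! i in vᵢ
    ... | false = below i v v⊆pivots (Supported-narrow v v<1+i vᵢ) v·V≡0
    ... | true  =
      ⊥-elim (pivot⇒∉span (v⊆pivots i vᵢ) (subst (Span (take i V)) v′·V (·∈span v′ (take i V))))
      where
      -- Clearing coordinate i of v exhibits the pivot V ‼ i as a combination of earlier vectors.
      i<n = !-true⇒< v i vᵢ
      v′ = v ⊕ unit {n} i
      v′<i : Supported (_< i) v′
      v′<i = Supported-narrow v′
        (Supported-⊕ v (unit i) v<1+i (λ k eₖ → ≤-reflexive (cong suc (unit-! {n} i eₖ))))
        (trans (!-⊕ v (unit i) i) (cong₂ _xor_ vᵢ (unit-!-self {n} i i<n)))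
      v′·V : v′ · take i V ≡ V ‼ i
      v′·V = begin
        v′ · take i V           ≡⟨ ·-take v′ V v′<i ⟩
        v′ · V                  ≡⟨ ·-⊕ v (unit {n} i) V ⟩
        v · V ⊕ unit {n} i · V  ≡⟨ cong₂ _⊕_ v·V≡0 (unit-· {n = n} i i<n V) ⟩
        zeroV ⊕ V ‼ i           ≡⟨ ⊕-identityˡ (V ‼ i) ⟩
        V ‼ i                   ∎
        where open ≡-Reasoning

  span⇒SpanOn-pivots : length V ≤ n → ∀ i → Span (take i V) y → SpanOn n Pivot V y
  span⇒SpanOn-pivots V≤n zero    ([] , refl) = SpanOn-zero
  span⇒SpanOn-pivots {n = n} V≤n (suc i) span with take-suc-‼ i V
  ... | inj₂ (same , _) = span⇒SpanOn-pivots V≤n i (subst (λ A → Span A _) same span)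
  ... | inj₁ snoc = span-closed SpanOn-zero SpanOn-⊕ generators (subst (λ A → Span A _) snoc span)
    where
    newest : SpanOn n Pivot V (V ‼ i)
    newest with isPivot i in pivot
    ... | true  = unit i , (λ k eₖ → subst Pivot (sym (unit-! {n} i eₖ)) pivot) ,
                  unit-· i (<-≤-trans (pivot⇒<length pivot) V≤n) V
    ... | false = span⇒SpanOn-pivots V≤n i (¬pivot⇒∈span pivot)
    generators : ∀ t → t ∈ take i V ++ [ V ‼ i ] → SpanOn n Pivot V t
    generators t t∈ with ∈-++⁻ (take i V) t∈
    ... | inj₁ t∈prefix    = span⇒SpanOn-pivots V≤n i (span-∈ t∈prefix)
    ... | inj₂ (here refl) = newest

  otherPivot : ℕ → ℕ → Bool
  otherPivot k j = isPivot j ∧ not (does (j ≟ℕ k))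

  coordinates : (n : ℕ) → F2 d → F2 n
  coordinates n y = tab n (λ k → isPivot k ∧ not (does (span? (select (otherPivot k) V) y)))

  coordinates-spec : length V ≤ n → Span V y →
                     Supported Pivot (coordinates n y) × coordinates n y · V ≡ y
  coordinates-spec {n = n} {y = y} V≤n y∈⟨V⟩ =
    subst (λ u → Supported Pivot u × u · V ≡ y) (sym (tab-! v coordinate)) (v⊆pivots , v·V)
    where
    representation = span⇒SpanOn-pivots V≤n (length V)
      (subst (λ A → Span A y) (sym (take-all (length V) V ≤-refl)) y∈⟨V⟩)
    v = proj₁ representation
    v⊆pivots = proj₁ (proj₂ representation)
    v·V = proj₂ (proj₂ representation)
    coordinate : ∀ k → k < n → isPivot k ∧ not (does (span? (select (otherPivot k) V) y)) ≡ v ! k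
    coordinate k _ with v ! k in vₖ
    ... | true = cong₂ _∧_ (v⊆pivots k vₖ) (cong not (dec-false (span? _ y) others∌y))
      where
      -- A representation of y avoiding k would be a second pivot-supported representation.
      others∌y : ¬ Span (select (otherPivot k) V) y
      others∌y y∈ with span-select⇒SpanOn (otherPivot k) V V≤n y∈
      ... | u , u⊆others , u·V with ⊕≡zero⇒≡ u v (pivots-independent (u ⊕ v)
              (Supported-⊕ u v (λ j → ∧-conicalˡ _ _ ∘ u⊆others j) v⊆pivots)
              (trans (·-⊕ u v V) (trans (cong₂ _⊕_ u·V v·V) (⊕-self y))))
      ... | refl = not-¬ refl
        (trans (sym (∧-conicalʳ _ _ (u⊆others k vₖ))) (cong not (dec-true (k ≟ℕ k) refl)))
    ... | false =
      trans (cong (λ b → isPivot k ∧ not b) (dec-true (span? _ y) others∋y)) (∧-zeroʳ (isPivot k))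
      where
      v⊆others : Supported (λ j → otherPivot k j ≡ true) v
      v⊆others j vⱼ = cong₂ _∧_ (v⊆pivots j vⱼ)
        (cong not (dec-false (j ≟ℕ k) λ { refl → not-¬ vₖ vⱼ }))
      others∋y : Span (select (otherPivot k) V) y
      others∋y = SpanOn⇒span-select (otherPivot k) V (v , v⊆others , v·V)

pivot-take : ∀ i (V : List (F2 d)) k → Pivot (take i V) k → Pivot V k × k < i
pivot-take i V k pivot with k <? i
... | yes k<i = subst (λ b → b ≡ true) same pivot , k<i
  where
  same : isPivot (take i V) k ≡ isPivot V k
  same = cong₂ (λ A y → not (does (span? A y)))
    (trans (take-take k i V) (cong (λ j → take j V) (m≤n⇒m⊓n≡m (<⇒≤ k<i))))
    (‼-take V k<i)
... | no  k≮i = ⊥-elim (pivot⇒∉span (take i V) pivot (subst (Span _) (sym zero-entry) span-zero))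
  where
  zero-entry : take i V ‼ k ≡ zeroV
  zero-entry = ‼-beyond (take i V)
    (≤-trans (≤-reflexive (length-take i V)) (≤-trans (m⊓n≤m i (length V)) (≮⇒≥ k≮i)))

coordinates-take : ∀ i (V : List (F2 d)) → length V ≤ n → Span (take i V) y →
                   Supported (Pivot V) (coordinates (take i V) n y) × coordinates (take i V) n y · V ≡ y
coordinates-take {n = n} {y = y} i V V≤n y∈ =
  (λ k cₖ → proj₁ (below k cₖ)) , trans (sym (·-take c V (λ k cₖ → proj₂ (below k cₖ)))) c·V
  where
  c = coordinates (take i V) n y
  spec = coordinates-spec (take i V)
    (≤-trans (≤-reflexive (length-take i V)) (≤-trans (m⊓n≤n i (length V)) V≤n)) y∈
  c·V = proj₂ spec
  below : ∀ k → c ! k ≡ true → Pivot V k × k < i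
  below k cₖ = pivot-take i V k (proj₁ spec k cₖ)

-- The greedy construction

module Greedy {E : Set} (rk : List E → ℕ) where

  raisesRank : List E → E → Bool
  raisesRank X y = does (rk X <? rk (y ∷ X))

  rankJump : List E → ℕ → Bool
  rankJump Q k = does (rk (take k Q) <? rk (take (suc k) Q))

  otherJump : List E → ℕ → ℕ → Bool
  otherJump Q k j = rankJump Q j ∧ not (does (j ≟ℕ k))

  greedyCoordinates : (n : ℕ) → List E → E → F2 n
  greedyCoordinates n Q y = tab n (λ k → rankJump Q k ∧ raisesRank (select (otherJump Q k) Q) y)

greedyCoordinates-map : {E E′ : Set} (rk : List E → ℕ) (g : E′ → E) (n : ℕ)
                        (Q : List E′) (y : E′) →
                        Greedy.greedyCoordinates (rk ∘ map g) n Q y ≡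
                        Greedy.greedyCoordinates rk n (map g Q) (g y)
greedyCoordinates-map rk g n Q y = tab-cong n λ k →
  cong₂ _∧_ (rankJump-map k) (cong (λ A → raisesRank A (g y))
    (trans (select-map g _ Q)
           (select-cong (λ j → cong (_∧ not (does (j ≟ℕ k))) (rankJump-map j)) (map g Q))))
  where
  open Greedy rk
  rankJump-map : ∀ k → Greedy.rankJump (rk ∘ map g) Q k ≡ rankJump (map g Q) k
  rankJump-map k = cong₂ (λ A B → does (rk A <? rk B)) (sym (take-map k Q)) (sym (take-map (suc k) Q))

module _ {E : Set} {rk : List E → ℕ} {w : E → F2 d} (w-rep : ∀ X → RankF2 (map w X) (rk X)) where
  open Greedy rk

  raisesRank-spec : ∀ X y → raisesRank X y ≡ not (does (span? (map w X) (w y)))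
  raisesRank-spec X y = rank-∷ (w-rep X) (w-rep (y ∷ X))

  rank-take : ∀ k Q → RankF2 (take k (map w Q)) (rk (take k Q))
  rank-take k Q = subst (λ A → RankF2 A (rk (take k Q))) (sym (take-map k Q)) (w-rep (take k Q))

  rankJump-spec : ∀ Q k → rankJump Q k ≡ isPivot (map w Q) k
  rankJump-spec Q k with take-suc-‼ k (map w Q)
  ... | inj₁ snoc =
    rank-∷ (rank-take k Q) (RankF2-∷ʳ (subst (λ A → RankF2 A _) snoc (rank-take (suc k) Q)))
  ... | inj₂ (same , zero-entry) = begin
    does (rk (take k Q) <? rk (take (suc k) Q))  ≡⟨ dec-false (_ <? _) (<-irrefl same-rank) ⟩
    false                                        ≡⟨ cong not (sym (dec-true (span? _ _) zero∈span)) ⟩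
    isPivot (map w Q) k                          ∎
    where
    open ≡-Reasoning
    same-rank = RankF2-unique (rank-take k Q) (subst (λ A → RankF2 A _) same (rank-take (suc k) Q))
    zero∈span = subst (Span (take k (map w Q))) (sym zero-entry) span-zero

  greedyCoordinates-spec : ∀ n Q y → greedyCoordinates n Q y ≡ coordinates (map w Q) n (w y)
  greedyCoordinates-spec n Q y = tab-cong n λ k →
    cong₂ _∧_ (rankJump-spec Q k) (trans (raisesRank-spec (select (otherJump Q k) Q) y)
      (cong (λ A → not (does (span? A (w y))))
        (trans (select-map w _ Q)
               (select-cong (λ j → cong (_∧ not (does (j ≟ℕ k))) (rankJump-spec Q j)) (map w Q)))))

-- The online morphism

take-tabulate : {X : Set} {m n : ℕ} (m≤n : m ≤ n) (f : Fin n → X) →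
                take m (tabulate f) ≡ tabulate (λ j → f (inject≤ j m≤n))
take-tabulate {m = zero}              _   f = refl
take-tabulate {m = suc m} {n = suc n} m≤n f = cong (f zero ∷_) (take-tabulate (s≤s⁻¹ m≤n) (f ∘ suc))

module _ (M : Matroid) (π : Ordering M) where

  enumeration : List (E M)
  enumeration = tabulate (Inverse.to π)

  position : E M → ℕ
  position x = toℕ (Inverse.from π x)

  history : E M → List (E M)
  history x = take (suc (position x)) enumeration

  ∈-history : ∀ x → x ∈ history x
  ∈-history x = subst (x ∈_) (sym (take-suc-tabulate (Inverse.to π) (Inverse.from π x)))
    (∈-++⁺ʳ _ (here (sym (Inverse.strictlyInverseˡ π x))))

onlineMap : (n : ℕ) (M : Matroid) → Ordering M → E M → F2 n
onlineMap n M π x = Greedy.greedyCoordinates (rank M) n (history M π x) x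

onlineMap-prefix : ∀ n (M : Matroid) (π : Ordering M) {m′} (m′≤m : m′ ≤ size M)
                   (x : PrefixE M π m′ m′≤m) →
                   onlineMap n (prefixMatroid M π m′ m′≤m) (prefixOrdering M π m′ m′≤m) x ≡
                   onlineMap n M π (proj₁ x)
onlineMap-prefix n M π {m′} m′≤m (x , x<m′) =
  trans (greedyCoordinates-map (rank M) proj₁ n _ (x , x<m′))
        (cong (λ Q → Greedy.greedyCoordinates (rank M) n Q x) history-prefix)
  where
  open ≡-Reasoning
  π′ = prefixOrdering M π m′ m′≤m
  history-prefix : map proj₁ (history (prefixMatroid M π m′ m′≤m) π′ (x , x<m′)) ≡ history M π x
  history-prefix = begin
    map proj₁ (take (suc (toℕ (fromℕ< x<m′))) (tabulate (Inverse.to π′)))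
      ≡⟨ sym (take-map _ (tabulate (Inverse.to π′))) ⟩
    take (suc (toℕ (fromℕ< x<m′))) (map proj₁ (tabulate (Inverse.to π′)))
      ≡⟨ cong₂ take (cong suc (toℕ-fromℕ< x<m′)) (map-tabulate (Inverse.to π′) proj₁) ⟩
    take (suc (position M π x)) (tabulate (λ j → Inverse.to π (inject≤ j m′≤m)))
      ≡⟨ cong (take _) (sym (take-tabulate m′≤m (Inverse.to π))) ⟩
    take (suc (position M π x)) (take m′ (enumeration M π))
      ≡⟨ take-take (suc (position M π x)) m′ _ ⟩
    take (suc (position M π x) ⊓ m′) (enumeration M π)
      ≡⟨ cong (λ i → take i (enumeration M π)) (m≤n⇒m⊓n≡m x<m′) ⟩
    history M π x ∎

module _ (n : ℕ) (M : Matroid) (π : Ordering M) {w : E M → F2 d}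
         (w-mor : IsMorphismF2 M d w) (M≤n : size M ≤ n) where
  private
    f = onlineMap n M π
    V = map w (enumeration M π)

  onlineMap-factors : ∀ x → Supported (Pivot V) (f x) × f x · V ≡ w x
  onlineMap-factors x = subst (λ u → Supported (Pivot V) u × u · V ≡ w x) (sym f≡coordinates)
    (coordinates-take (suc (position M π x)) V V≤n
      (subst (λ A → Span A (w x)) (sym (take-map _ _)) (span-∈ (∈-map⁺ w (∈-history M π x)))))
    where
    V≤n : length V ≤ n
    V≤n = ≤-trans (≤-reflexive (trans (length-map w (enumeration M π)) (length-tabulate (Inverse.to π))))
                  M≤n
    f≡coordinates : f x ≡ coordinates (take (suc (position M π x)) V) n (w x)
    f≡coordinates = trans (greedyCoordinates-spec w-mor n (history M π x) x)
                          (cong (λ A → coordinates A n (w x)) (sym (take-map _ _)))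

  onlineMap-sameDependencies : SameDependencies w f
  onlineMap-sameDependencies c U = mk⇔
    (λ w-dependent → pivots-independent V (c · map f U) (Supported-· c (map f U) fU⊆pivots)
                       (trans combination w-dependent))
    (λ f-dependent → trans (sym combination) (trans (cong (_· V) f-dependent) (·-zeroˡ n V)))
    where
    open ≡-Reasoning
    combination : (c · map f U) · V ≡ c · map w U
    combination = begin
      (c · map f U) · V
        ≡⟨ ·-natural (_· V) (λ u v → ·-⊕ u v V) (·-zeroˡ n V) c (map f U) ⟩
      c · map (_· V) (map f U)
        ≡⟨ cong (c ·_) (sym (map-∘ U)) ⟩
      c · map ((_· V) ∘ f) U
        ≡⟨ cong (c ·_) (map-cong (proj₂ ∘ onlineMap-factors) U) ⟩
      c · map w U
        ∎
    fU⊆pivots : ∀ t → t ∈ map f U → Supported (Pivot V) t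
    fU⊆pivots t t∈ with ∈-map⁻ f t∈
    ... | x , _ , refl = proj₁ (onlineMap-factors x)

  onlineMap-isMorphism : IsMorphismF2 M n f
  onlineMap-isMorphism S = RankF2-map w f onlineMap-sameDependencies S (w-mor S)

theorem1 : (n : ℕ) → 1 ≤ n → OnlineMorphism n
theorem1 n _ =
  onlineMap n ,
  (λ { M π ((d , w , w-mor) , M≤n) → onlineMap-isMorphism n M π w-mor M≤n }) ,
  (λ M π _ m′ m′<m → onlineMap-prefix n M π (<⇒≤ m′<m))
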